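{- Let $\ell\geqslant1$, $G$ a graph, and $X$ a subgraph of $G$ with $\mathrm{diam}(X)<\ell$ such that $Y:=G-V(X)$ is connected and contains a cycle. Let $t:=|E(X,Y)|$. Then $\mathbb{L}_\ell(G)$ contains a $K_{t+1}$-minor.
   Context: All graphs are finite, undirected and loopless; parallel edges are allowed (two parallel edges form a cycle of length 2). For $\ell\geqslant0$, an $\ell$-arc of $G$ is a sequence $(v_0,e_1,v_1,\ldots,e_\ell,v_\ell)$ with each $e_i$ an edge with ends $v_{i-1},v_i$ and $e_i\neq e_{i+1}$; an $\ell$-link is an $\ell$-arc identified with its reverse. The $\ell$-link graph $\mathbb{L}_\ell(G)$ has vertex set the $\ell$-links of $G$, and $\ell$-links $L,R$ are joined by as many edges as there are $(\ell+1)$-links $[v_0,e_1,\ldots,e_{\ell+1},v_{\ell+1}]$ with $\{[v_0,\ldots,v_\ell],[v_1,\ldots,v_{\ell+1}]\}=\{L,R\}$. $E(X,Y)$ is the set of edges of $G$ with one end in $V(X)$ and the other in $V(Y)$. $\mathrm{diam}(X)$ is the maximum distance in $X$ between two of its vertices ($+\infty$ if $X$ is disconnected). -}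

module Defs where

open import Data.Nat using (ℕ; zero; suc; _<_; _≤_)
open import Data.Fin using (Fin; zero; suc; inject₁; fromℕ; toℕ; opposite)
open import Data.Fin.Subset using (Subset; _∈_; _∉_; ∣_∣)
open import Data.Bool using (Bool; _xor_)
open import Data.Vec using (lookup; tabulate)
open import Data.Product using (Σ; ∃; ∃-syntax; _×_; _,_; proj₁; proj₂)
open import Data.Sum using (_⊎_)
open import Relation.Binary.PropositionalEquality using (_≡_; _≢_)
open import Relation.Nullary using (¬_)
open import Function.Definitions using (Injective)

-- Finite loopless multigraphs: vertices Fin n, edges Fin m, each edge
-- has a pair of (distinct) ends.  Parallel edges are allowed.

record Graph : Set where
  field
    nV       : ℕ
    nE       : ℕ
    ends     : Fin nE → Fin nV × Fin nV
    loopless : ∀ e → proj₁ (ends e) ≢ proj₂ (ends e)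

module _ (G : Graph) where
  open Graph G

  V : Set
  V = Fin nV

  E : Set
  E = Fin nE

  Joins : E → V → V → Set
  Joins e u v = (ends e ≡ (u , v)) ⊎ (ends e ≡ (v , u))

  -- Walks of length k: v₀ e₁ v₁ … e_k v_k  (vertices indexed by Fin (suc k),
  -- edges by Fin k, edge i joins vertex i and vertex i+1).

  record Walk (k : ℕ) : Set where
    field
      verts : Fin (suc k) → V
      edges : Fin k → E
      joins : ∀ (i : Fin k) → Joins (edges i) (verts (inject₁ i)) (verts (suc i))

  open Walk public

  start : ∀ {k} → Walk k → V
  start w = verts w zero

  end : ∀ {k} → Walk k → V
  end {k} w = verts w (fromℕ k)

  NonBacktracking : ∀ {k} → Walk k → Set
  NonBacktracking {k} w =
    ∀ (i j : Fin k) → toℕ j ≡ suc (toℕ i) → edges w i ≢ edges w j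

  record Arc (ℓ : ℕ) : Set where
    field
      walk  : Walk ℓ
      nonbt : NonBacktracking walk

  open Arc public

  Raw : ℕ → Set
  Raw ℓ = (Fin (suc ℓ) → V) × (Fin ℓ → E)

  raw : ∀ {ℓ} → Arc ℓ → Raw ℓ
  raw A = verts (walk A) , edges (walk A)

  SameSeq : ∀ {ℓ} → Raw ℓ → Raw ℓ → Set
  SameSeq (vs , es) (ws , fs) = (∀ i → vs i ≡ ws i) × (∀ i → es i ≡ fs i)

  revRaw : ∀ {ℓ} → Raw ℓ → Raw ℓ
  revRaw (vs , es) = (λ i → vs (opposite i)) , (λ i → es (opposite i))

  -- two arc sequences represent the same ℓ-link (arc identified with reverse)
  SameLink : ∀ {ℓ} → Raw ℓ → Raw ℓ → Set
  SameLink r s = SameSeq r s ⊎ SameSeq r (revRaw s)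

  initRaw : ∀ {ℓ} → Raw (suc ℓ) → Raw ℓ
  initRaw (vs , es) = (λ i → vs (inject₁ i)) , (λ i → es (inject₁ i))

  tailRaw : ∀ {ℓ} → Raw (suc ℓ) → Raw ℓ
  tailRaw (vs , es) = (λ i → vs (suc i)) , (λ i → es (suc i))

  -- The ℓ-link graph 𝕃_ℓ(G): vertices are ℓ-links (ℓ-arcs up to SameLink),
  -- and links L, R are adjacent iff there is an (ℓ+1)-arc whose initial and
  -- final ℓ-subarcs are {L, R}.  (Edge multiplicities are irrelevant for
  -- the existence of a complete-graph minor; only adjacency is recorded.)

  LinkAdj : ∀ ℓ → Arc ℓ → Arc ℓ → Set
  LinkAdj ℓ L R = Σ (Arc (suc ℓ)) λ A →
      (SameLink (raw L) (initRaw (raw A)) × SameLink (raw R) (tailRaw (raw A)))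
    ⊎ (SameLink (raw R) (initRaw (raw A)) × SameLink (raw L) (tailRaw (raw A)))

  -- a set of vertices of 𝕃_ℓ(G): a predicate on arcs closed under SameLink
  LinkSet : ℕ → Set₁
  LinkSet ℓ = Arc ℓ → Set

  RespectsLink : ∀ {ℓ} → LinkSet ℓ → Set
  RespectsLink {ℓ} B = ∀ (A A′ : Arc ℓ) → SameLink (raw A) (raw A′) → B A → B A′

  ConnectedIn : ∀ ℓ → LinkSet ℓ → Set
  ConnectedIn ℓ B = ∀ (A A′ : Arc ℓ) → B A → B A′ →
    Σ ℕ λ k → Σ (Fin (suc k) → Arc ℓ) λ P →
        SameLink (raw (P zero)) (raw A)
      × SameLink (raw (P (fromℕ k))) (raw A′)
      × (∀ j → B (P j))
      × (∀ (i : Fin k) → LinkAdj ℓ (P (inject₁ i)) (P (suc i)))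

  HasCompleteMinorInLinkGraph : ℕ → ℕ → Set₁
  HasCompleteMinorInLinkGraph ℓ r = Σ (Fin r → LinkSet ℓ) λ B →
      (∀ i → RespectsLink (B i))
    × (∀ i → Σ (Arc ℓ) (B i))
    × (∀ i → ConnectedIn ℓ (B i))
    × (∀ i j → i ≢ j → ∀ (A : Arc ℓ) → B i A → ¬ B j A)
    × (∀ i j → i ≢ j → Σ (Arc ℓ) λ A → Σ (Arc ℓ) λ A′ →
         B i A × B j A′ × LinkAdj ℓ A A′)

  IsSubgraph : Subset nV → Subset nE → Set
  IsSubgraph VX EX = ∀ e → e ∈ EX → proj₁ (ends e) ∈ VX × proj₂ (ends e) ∈ VX

  WalkIn : Subset nV → Subset nE → ∀ {k} → Walk k → Set
  WalkIn VX EX {k} w = (∀ i → verts w i ∈ VX) × (∀ (i : Fin k) → edges w i ∈ EX)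

  DiamLess : Subset nV → Subset nE → ℕ → Set
  DiamLess VX EX ℓ = ∀ u v → u ∈ VX → v ∈ VX →
    Σ ℕ λ k → k < ℓ × Σ (Walk k) λ w →
      WalkIn VX EX w × start w ≡ u × end w ≡ v

  -- walks in Y = G - V(X): all vertices outside VX (then all edges are
  -- edges of Y, as Y is the induced subgraph on the complement)
  AvoidsV : Subset nV → ∀ {k} → Walk k → Set
  AvoidsV VX w = ∀ i → verts w i ∉ VX

  ComplementConnected : Subset nV → Set
  ComplementConnected VX = ∀ u v → u ∉ VX → v ∉ VX →
    Σ ℕ λ k → Σ (Walk k) λ w → AvoidsV VX w × start w ≡ u × end w ≡ v

  ComplementHasCycle : Subset nV → Set
  ComplementHasCycle VX = Σ ℕ λ k → 2 ≤ k × Σ (Walk k) λ w →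
      start w ≡ end w
    × Injective _≡_ _≡_ (λ (i : Fin k) → verts w (inject₁ i))
    × Injective _≡_ _≡_ (edges w)
    × AvoidsV VX w

  crossing : Subset nV → Subset nE
  crossing VX = tabulate λ e → lookup VX (proj₁ (ends e)) xor lookup VX (proj₂ (ends e))

  crossingCount : Subset nV → ℕ
  crossingCount VX = ∣ crossing VX ∣

module Submission where

-- Let ℓ ≥ 1, Y = G - V(X), C a cycle of Y, and let
-- e₁ < … < e_t be the crossing edges E(X,Y), eᵢ = xᵢyᵢ with xᵢ ∈ X.  Each eᵢ
-- starts a non-backtracking ray Sᵢ = xᵢ eᵢ yᵢ … that stays in Y and winds
-- around C forever; Tᵢ is its first ℓ-window.  The branch sets are
--   B₀ : ℓ-links inside Y reachable (through such links) from a window of C,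
--   Bᵢ : ℓ-links with least crossing edge eᵢ reachable (likewise) from Tᵢ.
-- Defining branch sets by reachability makes them connected; the two
-- predicates make them disjoint.  Every adjacency comes from consecutive
-- windows of an infinite non-backtracking walk: B₀–Bᵢ along Sᵢ, and Bᵢ–Bⱼ
-- (eᵢ < eⱼ) along the walk that runs Sⱼ backwards into X, crosses X on a
-- path of length < ℓ to xᵢ and continues along Sᵢ.

open import Defs
open import Data.Nat using (ℕ; zero; suc; _+_; _∸_; _≤_; _<_; z≤n; s≤s; s≤s⁻¹; _<?_)
open import Data.Nat.Properties
open import Data.Fin as Fin using (Fin; zero; suc; toℕ; inject₁; fromℕ; fromℕ<; opposite)
open import Data.Fin.Properties using (toℕ-inject₁; toℕ-injective; toℕ-fromℕ; toℕ-fromℕ<; toℕ<n; opposite-prop; opposite-involutive)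
import Data.Fin.Properties as FinP
open import Data.Fin.Subset using (Subset; _∈_; _∉_; ∣_∣)
open import Data.Bool using (true; false; _xor_)
open import Data.Vec using (_∷_; lookup)
open import Data.Vec.Properties using (lookup∘tabulate; []=⇒lookup; lookup⇒[]=)
open import Data.Product using (Σ; _×_; _,_; proj₁; proj₂)
open import Data.Sum using (_⊎_; inj₁; inj₂)
open import Data.Empty using (⊥; ⊥-elim)
open import Data.Unit using (⊤; tt)
open import Relation.Binary using (tri<; tri≈; tri>)
open import Relation.Binary.PropositionalEquality
open import Relation.Nullary using (¬_; yes; no)
open import Function.Definitions using (Injective)

module LinkFacts (G : Graph) where

  module _ {k : ℕ} where
    ss-refl : (r : Raw G k) → SameSeq G r r
    ss-refl r = (λ _ → refl) , (λ _ → refl)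

    ss-sym : {r s : Raw G k} → SameSeq G r s → SameSeq G s r
    ss-sym (a , b) = (λ i → sym (a i)) , (λ i → sym (b i))

    ss-trans : {r s t : Raw G k} → SameSeq G r s → SameSeq G s t → SameSeq G r t
    ss-trans (a , b) (c , d) = (λ i → trans (a i) (c i)) , (λ i → trans (b i) (d i))

    rev-cong : {r s : Raw G k} → SameSeq G r s → SameSeq G (revRaw G r) (revRaw G s)
    rev-cong (a , b) = (λ i → a (opposite i)) , (λ i → b (opposite i))

    rev-involutive : (r : Raw G k) → SameSeq G (revRaw G (revRaw G r)) r
    rev-involutive r =
      (λ i → cong (proj₁ r) (opposite-involutive i)) , (λ i → cong (proj₂ r) (opposite-involutive i))

    sl-refl : (r : Raw G k) → SameLink G r r
    sl-refl r = inj₁ (ss-refl r)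

    sl-sym : {r s : Raw G k} → SameLink G r s → SameLink G s r
    sl-sym (inj₁ x) = inj₁ (ss-sym x)
    sl-sym {r} {s} (inj₂ x) = inj₂ (ss-sym (ss-trans (rev-cong x) (rev-involutive s)))

    sl-trans : {r s t : Raw G k} → SameLink G r s → SameLink G s t → SameLink G r t
    sl-trans (inj₁ x) (inj₁ y) = inj₁ (ss-trans x y)
    sl-trans (inj₁ x) (inj₂ y) = inj₂ (ss-trans x y)
    sl-trans (inj₂ x) (inj₁ y) = inj₂ (ss-trans x (rev-cong y))
    sl-trans {t = t} (inj₂ x) (inj₂ y) = inj₁ (ss-trans x (ss-trans (rev-cong y) (rev-involutive t)))

  adj-sym : ∀ {ℓ} {L R : Arc G ℓ} → LinkAdj G ℓ L R → LinkAdj G ℓ R L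
  adj-sym (A , inj₁ x) = A , inj₂ x
  adj-sym (A , inj₂ x) = A , inj₁ x

  adj-respˡ : ∀ {ℓ} {L L′ R : Arc G ℓ} → SameLink G (raw G L) (raw G L′) →
    LinkAdj G ℓ L R → LinkAdj G ℓ L′ R
  adj-respˡ s (A , inj₁ (a , b)) = A , inj₁ (sl-trans (sl-sym s) a , b)
  adj-respˡ s (A , inj₂ (a , b)) = A , inj₂ (a , sl-trans (sl-sym s) b)

  adj-respʳ : ∀ {ℓ} {L R R′ : Arc G ℓ} → SameLink G (raw G R) (raw G R′) →
    LinkAdj G ℓ L R → LinkAdj G ℓ L R′
  adj-respʳ {L = L} {R} {R′} s a =
    adj-sym {L = R′} {R = L} (adj-respˡ {L = R} {L′ = R′} {R = L} s (adj-sym {L = L} {R = R} a))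

  Touching : ∀ {ℓ} → LinkSet G ℓ → LinkSet G ℓ → Set
  Touching {ℓ} B B′ = Σ (Arc G ℓ) λ A → Σ (Arc G ℓ) λ A′ → B A × B′ A′ × LinkAdj G ℓ A A′

  touching-sym : ∀ {ℓ} {B B′ : LinkSet G ℓ} → Touching B B′ → Touching B′ B
  touching-sym (A , A′ , a , a′ , adj) = A′ , A , a′ , a , adj-sym {L = A} {R = A′} adj

  vertex-of-same : ∀ {ℓ} {A A′ : Arc G ℓ} → SameLink G (raw G A) (raw G A′) →
    ∀ p → Σ (Fin (suc ℓ)) λ q → verts (walk A′) p ≡ verts (walk A) q
  vertex-of-same (inj₁ (a , _)) p = p , sym (a p)
  vertex-of-same {A = A} {A′} (inj₂ (a , _)) p =
    opposite p , trans (cong (verts (walk A′)) (sym (opposite-involutive p))) (sym (a (opposite p)))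

  edge-of-same : ∀ {ℓ} {A A′ : Arc G ℓ} → SameLink G (raw G A) (raw G A′) →
    ∀ p → Σ (Fin ℓ) λ q → edges (walk A′) p ≡ edges (walk A) q
  edge-of-same (inj₁ (_ , a)) p = p , sym (a p)
  edge-of-same {A = A} {A′} (inj₂ (_ , a)) p =
    opposite p , trans (cong (edges (walk A′)) (sym (opposite-involutive p))) (sym (a (opposite p)))

module Chains (G : Graph) (ℓ : ℕ) (Q : Arc G ℓ → Set)
    (Q-resp : ∀ A A′ → SameLink G (raw G A) (raw G A′) → Q A → Q A′) where
  open LinkFacts G

  data Chain : Arc G ℓ → Arc G ℓ → Set where
    stop : ∀ {A C} → Q A → SameLink G (raw G A) (raw G C) → Chain A C
    step : ∀ {A B C} → Q A → LinkAdj G ℓ A B → Chain B C → Chain A C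

  chain-start : ∀ {A C} → Chain A C → Q A
  chain-start (stop q _) = q
  chain-start (step q _ _) = q

  chain-end : ∀ {A C} → Chain A C → Q C
  chain-end (stop q s) = Q-resp _ _ s q
  chain-end (step _ _ c) = chain-end c

  restart : ∀ {A A′ C} → SameLink G (raw G A′) (raw G A) → Q A′ → Chain A C → Chain A′ C
  restart s q (stop _ s₂) = stop q (sl-trans s s₂)
  restart {A} {A′} s q (step {B = B} _ adj c) =
    step q (adj-respˡ {L = A} {L′ = A′} {R = B} (sl-sym s) adj) c

  extend : ∀ {A C C′} → Chain A C → SameLink G (raw G C) (raw G C′) → Chain A C′
  extend (stop q s) s′ = stop q (sl-trans s s′)
  extend (step q a c) s′ = step q a (extend c s′)

  append : ∀ {A B B′ C} → Chain A B → Chain B′ C → SameLink G (raw G B) (raw G B′) → Chain A C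
  append (stop q s) c₂ s′ = restart (sl-trans s s′) q c₂
  append (step q a c) c₂ s′ = step q a (append c c₂ s′)

  reverse : ∀ {A C} → Chain A C → Chain C A
  reverse (stop q s) = stop (Q-resp _ _ s q) (sl-sym s)
  reverse (step {A} {B} q adj c) =
    append (reverse c) (step (chain-start c) (adj-sym {L = A} {R = B} adj) (stop q (sl-refl _))) (sl-refl _)

  module BranchSet (s : Arc G ℓ) where

    Branch : LinkSet G ℓ
    Branch A = Chain s A

    grow : ∀ {A B} → Chain s A → LinkAdj G ℓ A B → Q B → Chain s B
    grow h adj qB = append h (step (chain-end h) adj (stop qB (sl-refl _))) (sl-refl _)

    toPath : ∀ {A C} → Chain A C → Chain s A →
      Σ ℕ λ k → Σ (Fin (suc k) → Arc G ℓ) λ P →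
        P zero ≡ A × SameLink G (raw G (P (fromℕ k))) (raw G C) ×
        (∀ j → Branch (P j)) × (∀ (i : Fin k) → LinkAdj G ℓ (P (inject₁ i)) (P (suc i)))
    toPath {A} (stop q sl) h = 0 , (λ _ → A) , refl , sl , (λ _ → h) , (λ ())
    toPath {A} (step q adj c) h with toPath c (grow h adj (chain-start c))
    ... | k , P , P₀ , Pₖ , inB , isPath = suc k , P′ , refl , Pₖ , inB′ , isPath′
      where
      P′ : Fin (suc (suc k)) → Arc G ℓ
      P′ zero = A
      P′ (suc j) = P j
      inB′ : ∀ j → Branch (P′ j)
      inB′ zero = h
      inB′ (suc j) = inB j
      isPath′ : ∀ (i : Fin (suc k)) → LinkAdj G ℓ (P′ (inject₁ i)) (P′ (suc i))
      isPath′ zero = subst (LinkAdj G ℓ A) (sym P₀) adj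
      isPath′ (suc i) = isPath i

    branch-resp : RespectsLink G Branch
    branch-resp A A′ sl c = extend c sl

    branch-nonempty : Q s → Σ (Arc G ℓ) Branch
    branch-nonempty q = s , stop q (sl-refl _)

    branch-connected : ConnectedIn G ℓ Branch
    branch-connected A A′ c₁ c₂ with toPath (append (reverse c₁) c₂ (sl-refl _)) c₁
    ... | k , P , P₀ , Pₖ , inB , isPath =
      k , P , subst (λ Z → SameLink G (raw G Z) (raw G A)) (sym P₀) (sl-refl _) , Pₖ , inB , isPath

-- Every ℓ-window
-- of a non-backtracking infinite walk is an ℓ-arc, and consecutive windows
-- are adjacent in 𝕃_ℓ(G); this is the only source of adjacencies we use.
module InfiniteWalks (G : Graph) where
  open Graph G
  open LinkFacts G

  record Seq : Set where
    constructor mkSeq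
    field
      vs : ℕ → Fin nV
      es : ℕ → Fin nE
  open Seq public

  NBSeq : Seq → Set
  NBSeq S = (∀ n → Joins G (es S n) (vs S n) (vs S (suc n))) × (∀ n → es S n ≢ es S (suc n))

  shift : Seq → ℕ → Seq
  shift S m = mkSeq (λ q → vs S (m + q)) (λ q → es S (m + q))

  shift-NB : ∀ S m → NBSeq S → NBSeq (shift S m)
  shift-NB S m (j , nb) =
    (λ n → subst (Joins G (es S (m + n)) (vs S (m + n))) (cong (vs S) (sym (+-suc m n))) (j (m + n))) ,
    (λ n eq → nb (m + n) (trans eq (cong (es S) (+-suc m n))))

  window : ∀ ℓ S → NBSeq S → ℕ → Arc G ℓ
  window ℓ S (j , nb) m = record
    { walk = record
      { verts = λ q → vs S (m + toℕ q)
      ; edges = λ q → es S (m + toℕ q)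
      ; joins = λ i → subst₂ (Joins G (es S (m + toℕ i)))
                        (cong (λ x → vs S (m + x)) (sym (toℕ-inject₁ i)))
                        (cong (vs S) (sym (+-suc m (toℕ i))))
                        (j (m + toℕ i)) }
    ; nonbt = λ i i′ i′≡1+i eq →
        nb (m + toℕ i) (trans eq (trans (cong (λ x → es S (m + x)) i′≡1+i) (cong (es S) (+-suc m (toℕ i))))) }

  module Windows (ℓ : ℕ) (S : Seq) (v : NBSeq S) where

    win : ℕ → Arc G ℓ
    win = window ℓ S v

    win-cong : ∀ {m m′} → m ≡ m′ → SameLink G (raw G (win m)) (raw G (win m′))
    win-cong refl = sl-refl _

    -- consecutive windows are the two ℓ-subarcs of an (ℓ+1)-window
    win-adj : ∀ m → LinkAdj G ℓ (win m) (win (suc m))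
    win-adj m = window (suc ℓ) S v m ,
      inj₁ (inj₁ ((λ i → cong (λ x → vs S (m + x)) (sym (toℕ-inject₁ i))) ,
                  (λ i → cong (λ x → es S (m + x)) (sym (toℕ-inject₁ i)))) ,
            inj₁ ((λ i → cong (vs S) (sym (+-suc m (toℕ i)))) ,
                  (λ i → cong (es S) (sym (+-suc m (toℕ i))))))

    module _ (Q : Arc G ℓ → Set) (Q-resp : ∀ A A′ → SameLink G (raw G A) (raw G A′) → Q A → Q A′) where
      open Chains G ℓ Q Q-resp

      slide : ∀ a n → (∀ m → a ≤ m → m ≤ a + n → Q (win m)) → Chain (win a) (win (a + n))
      slide a zero h = stop (h a ≤-refl (m≤m+n a 0)) (win-cong (sym (+-identityʳ a)))
      slide a (suc n) h =
        step (h a ≤-refl (m≤m+n a (suc n))) (win-adj a)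
          (extend (slide (suc a) n (λ m a<m m≤ → h m (<⇒≤ a<m) (≤-trans m≤ (≤-reflexive (sym (+-suc a n))))))
                  (win-cong (sym (+-suc a n))))

  joins-sym : ∀ {e u v} → Joins G e u v → Joins G e v u
  joins-sym (inj₁ x) = inj₂ x
  joins-sym (inj₂ x) = inj₁ x

  -- an edge determines its other end (this uses looplessness)
  other-end : ∀ {e a b c} → Joins G e a b → Joins G e b c → c ≡ a
  other-end {e} (inj₁ x) (inj₁ y) =
    ⊥-elim (loopless e (trans (cong proj₁ x) (trans (cong proj₁ (trans (sym x) y)) (sym (cong proj₂ x)))))
  other-end (inj₁ x) (inj₂ y) = sym (cong proj₁ (trans (sym x) y))
  other-end (inj₂ x) (inj₁ y) = cong proj₂ (trans (sym y) x)
  other-end {e} (inj₂ x) (inj₂ y) =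
    ⊥-elim (loopless e (trans (cong proj₁ x) (trans (sym (cong proj₂ (trans (sym x) y))) (sym (cong proj₂ x)))))

  prepend : Fin nV → Fin nE → Seq → Seq
  prepend u e S = mkSeq (λ { zero → u ; (suc n) → vs S n }) (λ { zero → e ; (suc n) → es S n })

  prepend-NB : ∀ {u e S} → NBSeq S → Joins G e u (vs S 0) → e ≢ es S 0 → NBSeq (prepend u e S)
  prepend-NB {u} {e} {S} (j , nb) j₀ ne = js , nbs
    where
    js : ∀ n → Joins G (es (prepend u e S) n) (vs (prepend u e S) n) (vs (prepend u e S) (suc n))
    js zero = j₀
    js (suc n) = j n
    nbs : ∀ n → es (prepend u e S) n ≢ es (prepend u e S) (suc n)
    nbs zero = ne
    nbs (suc n) = nb n

  -- revPre S k F = v_k e_{k-1} … e₀ v₀ followed by F (where F starts at v₀)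
  revPre : Seq → ℕ → Seq → Seq
  revPre S zero F = F
  revPre S (suc k) F = prepend (vs S (suc k)) (es S k) (revPre S k F)

  revPre-head : ∀ S k F → vs F 0 ≡ vs S 0 → vs (revPre S k F) 0 ≡ vs S k
  revPre-head S zero F h = h
  revPre-head S (suc k) F h = refl

  revPre-NB : ∀ S k F → NBSeq S → NBSeq F → vs F 0 ≡ vs S 0 → es S 0 ≢ es F 0 → NBSeq (revPre S k F)
  revPre-NB S zero F vS vF h ne = vF
  revPre-NB S (suc k) F vS vF h ne =
    prepend-NB (revPre-NB S k F vS vF h ne)
      (subst (Joins G (es S k) (vs S (suc k))) (sym (revPre-head S k F h)) (joins-sym (proj₁ vS k)))
      (differs k)
    where
    differs : ∀ k → es S k ≢ es (revPre S k F) 0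
    differs zero = ne
    differs (suc k) eq = proj₂ vS k (sym eq)

  revPre-far-v : ∀ S k F n → vs (revPre S k F) (k + n) ≡ vs F n
  revPre-far-v S zero F n = refl
  revPre-far-v S (suc k) F n = revPre-far-v S k F n

  revPre-far-e : ∀ S k F n → es (revPre S k F) (k + n) ≡ es F n
  revPre-far-e S zero F n = refl
  revPre-far-e S (suc k) F n = revPre-far-e S k F n

  revPre-near-v : ∀ S k F q → q ≤ k → vs F 0 ≡ vs S 0 → vs (revPre S k F) q ≡ vs S (k ∸ q)
  revPre-near-v S zero F zero le h = h
  revPre-near-v S (suc k) F zero le h = refl
  revPre-near-v S (suc k) F (suc q) (s≤s le) h = revPre-near-v S k F q le h

  revPre-near-e : ∀ S k F q → q < k → es (revPre S k F) q ≡ es S (k ∸ suc q)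
  revPre-near-e S (suc k) F zero le = refl
  revPre-near-e S (suc k) F (suc q) (s≤s le) = revPre-near-e S k F q le

  EdgesUpTo : (Fin nE → Set) → Seq → ℕ → Set
  EdgesUpTo Π S d = ∀ n → n < d → Π (es S n)

  revPre-edges : ∀ Π S k F d → (∀ n → Π (es S n)) → EdgesUpTo Π F d → EdgesUpTo Π (revPre S k F) (k + d)
  revPre-edges Π S zero F d hS hF = hF
  revPre-edges Π S (suc k) F d hS hF zero lt = hS k
  revPre-edges Π S (suc k) F d hS hF (suc n) (s≤s lt) = revPre-edges Π S k F d hS hF n lt

module FiniteWalks (G : Graph) (P : Fin (Graph.nV G) → Set) where
  open Graph G
  open InfiniteWalks G

  data PWalk : Fin nV → ℕ → Set where
    nil  : ∀ {u} → P u → PWalk u 0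
    cons : ∀ {u n} (e : Fin nE) (u₁ : Fin nV) → Joins G e u u₁ → P u → PWalk u₁ n → PWalk u (suc n)

  endV : ∀ {u n} → PWalk u n → Fin nV
  endV {u} (nil _) = u
  endV (cons _ _ _ _ w) = endV w

  FirstEdgeNot : ∀ {u n} → Fin nE → PWalk u n → Set
  FirstEdgeNot e (nil _) = ⊤
  FirstEdgeNot e (cons g _ _ _ _) = e ≢ g

  LastEdgeNot : ∀ {u n} → PWalk u n → Fin nE → Set
  LastEdgeNot (nil _) f = ⊤
  LastEdgeNot (cons e _ _ _ (nil _)) f = e ≢ f
  LastEdgeNot (cons e _ _ _ w@(cons _ _ _ _ _)) f = LastEdgeNot w f

  NonBacktrackingW : ∀ {u n} → PWalk u n → Set
  NonBacktrackingW (nil _) = ⊤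
  NonBacktrackingW (cons e _ _ _ w) = FirstEdgeNot e w × NonBacktrackingW w

  AllEdges : ∀ {u n} → (Fin nE → Set) → PWalk u n → Set
  AllEdges Π (nil _) = ⊤
  AllEdges Π (cons e _ _ _ w) = Π e × AllEdges Π w

  allEdges-map : ∀ {u n} {Π Π′ : Fin nE → Set} → (∀ {f} → Π f → Π′ f) →
    (w : PWalk u n) → AllEdges Π w → AllEdges Π′ w
  allEdges-map h (nil _) _ = tt
  allEdges-map h (cons e _ _ _ w) (a , b) = h a , allEdges-map h w b

  lastEdgeNot-from-all : ∀ {u n} (Π : Fin nE → Set) f → ¬ Π f → (w : PWalk u n) → AllEdges Π w → LastEdgeNot w f
  lastEdgeNot-from-all Π f nf (nil _) _ = tt
  lastEdgeNot-from-all Π f nf (cons e _ _ _ (nil _)) (pe , _) eq = nf (subst Π eq pe)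
  lastEdgeNot-from-all Π f nf (cons _ _ _ _ w@(cons _ _ _ _ _)) (_ , aw) = lastEdgeNot-from-all Π f nf w aw

  headP : ∀ {u n} → PWalk u n → P u
  headP (nil p) = p
  headP (cons _ _ _ p _) = p

  allEdges-of : ∀ {u n} (Π : Fin nE → Set) → (∀ e a b → P a → P b → Joins G e a b → Π e) →
    (w : PWalk u n) → AllEdges Π w
  allEdges-of Π h (nil _) = tt
  allEdges-of Π h (cons e u₁ j p w) = h e _ u₁ p (headP w) j , allEdges-of Π h w

  reroot : ∀ {u u′ n} → u ≡ u′ → PWalk u n → PWalk u′ n
  reroot refl w = w

  reroot-end : ∀ {u u′ n} (eq : u ≡ u′) (w : PWalk u n) → endV (reroot eq w) ≡ endV w
  reroot-end refl w = refl

  reroot-NB : ∀ {u u′ n} (eq : u ≡ u′) (w : PWalk u n) → NonBacktrackingW w → NonBacktrackingW (reroot eq w)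
  reroot-NB refl w x = x

  Reduced : Fin nV → ℕ → Fin nV → Set
  Reduced u n v = Σ ℕ λ m → m ≤ n × Σ (PWalk u m) λ w → NonBacktrackingW w × endV w ≡ v

  -- prepending an edge either keeps the walk non-backtracking or cancels
  -- against its first edge (then e leads back to u)
  reduce-cons : ∀ {u n v} e u₁ → Joins G e u u₁ → P u → Reduced u₁ n v → Reduced u (suc n) v
  reduce-cons e u₁ j p (_ , _ , nil p′ , _ , ev) =
    1 , s≤s z≤n , cons e u₁ j p (nil p′) , (tt , tt) , ev
  reduce-cons e u₁ j p (suc m , le , cons g u₂ j′ p′ w , nb , ev) with e Fin.≟ g
  ... | no ne = suc (suc m) , s≤s le , cons e u₁ j p (cons g u₂ j′ p′ w) , (ne , nb) , ev
  ... | yes refl =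
    m , ≤-trans (n≤1+n m) (≤-trans le (n≤1+n _)) , reroot back w , reroot-NB back w (proj₂ nb) ,
    trans (reroot-end back w) ev
    where
    back = other-end j j′

  reduce : ∀ {u n} (w : PWalk u n) → Reduced u n (endV w)
  reduce (nil p) = 0 , z≤n , nil p , tt , refl
  reduce (cons e u₁ j p w) = reduce-cons e u₁ j p (reduce w)

  fromWalk : ∀ k (w : Walk G k) → (∀ i → P (verts w i)) → Σ (PWalk (start G w) k) λ lw → endV lw ≡ end G w
  fromWalk zero w h = nil (h zero) , refl
  fromWalk (suc k) w h with fromWalk k tail (λ i → h (suc i))
    where
    tail : Walk G k
    tail = record { verts = λ i → verts w (suc i) ; edges = λ i → edges w (suc i) ; joins = λ i → joins w (suc i) }
  ... | lw , ev = cons (edges w zero) (verts w (suc zero)) (joins w zero) (h zero) lw , ev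

  reduceWalk : ∀ {u v} k (w : Walk G k) → (∀ i → P (verts w i)) → start G w ≡ u → end G w ≡ v → Reduced u k v
  reduceWalk k w h st en with fromWalk k w h
  ... | lw , ev with reduce (reroot st lw)
  ... | m , m≤k , r , nb , ev′ = m , m≤k , r , nb , trans ev′ (trans (reroot-end st lw) (trans ev en))

  prependWalk : ∀ {u n} → PWalk u n → Seq → Seq
  prependWalk {u} (nil _) S = S
  prependWalk {u} (cons e _ _ _ w) S = prepend u e (prependWalk w S)

  prependWalk-head : ∀ {u n} (w : PWalk u n) S → endV w ≡ vs S 0 → vs (prependWalk w S) 0 ≡ u
  prependWalk-head (nil _) S h = sym h
  prependWalk-head (cons _ _ _ _ _) S h = refl

  prependWalk-NB : ∀ {u n} (w : PWalk u n) S → NBSeq S → NonBacktrackingW w → LastEdgeNot w (es S 0) →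
    endV w ≡ vs S 0 → NBSeq (prependWalk w S)
  prependWalk-NB (nil _) S v _ _ _ = v
  prependWalk-NB (cons e u₁ j p (nil _)) S v _ last ev = prepend-NB v (subst (Joins G e _) ev j) last
  prependWalk-NB (cons e u₁ j p w@(cons _ _ _ _ _)) S v (hn , nb) last ev =
    prepend-NB (prependWalk-NB w S v nb last ev) (subst (Joins G e _) (sym (prependWalk-head w S ev)) j) hn

  prependWalk-far-v : ∀ {u n} (w : PWalk u n) S q → vs (prependWalk w S) (n + q) ≡ vs S q
  prependWalk-far-v (nil _) S q = refl
  prependWalk-far-v (cons _ _ _ _ w) S q = prependWalk-far-v w S q

  prependWalk-far-e : ∀ {u n} (w : PWalk u n) S q → es (prependWalk w S) (n + q) ≡ es S q
  prependWalk-far-e (nil _) S q = refl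
  prependWalk-far-e (cons _ _ _ _ w) S q = prependWalk-far-e w S q

  prependWalk-verts : ∀ {u n} (w : PWalk u n) S → (∀ q → P (vs S q)) → ∀ q → P (vs (prependWalk w S) q)
  prependWalk-verts (nil _) S h q = h q
  prependWalk-verts (cons _ _ _ p w) S h zero = p
  prependWalk-verts (cons _ _ _ _ w) S h (suc q) = prependWalk-verts w S h q

  prependWalk-edges : ∀ {u n} (Π : Fin nE → Set) (w : PWalk u n) S d → AllEdges Π w →
    EdgesUpTo Π S d → EdgesUpTo Π (prependWalk w S) (n + d)
  prependWalk-edges Π (nil _) S d _ h = h
  prependWalk-edges Π (cons e _ _ _ w) S d (pe , aw) h zero lt = pe
  prependWalk-edges Π (cons e _ _ _ w) S d (pe , aw) h (suc q) (s≤s lt) = prependWalk-edges Π w S d aw h q lt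

module CrossingEdges (G : Graph) (VX : Subset (Graph.nV G)) where
  open Graph G

  Crossing : Fin nE → Set
  Crossing f = lookup (crossing G VX) f ≡ true

  NonCrossing : Fin nE → Set
  NonCrossing f = lookup (crossing G VX) f ≡ false

  true≢false : true ≢ false
  true≢false ()

  nonCrossing⇒¬crossing : ∀ {f} → NonCrossing f → ¬ Crossing f
  nonCrossing⇒¬crossing nc c = true≢false (trans (sym c) nc)

  crossing-lookup : ∀ f → lookup (crossing G VX) f ≡ (lookup VX (proj₁ (ends f)) xor lookup VX (proj₂ (ends f)))
  crossing-lookup f = lookup∘tabulate _ f

  xor-self : ∀ b → (b xor b) ≡ false
  xor-self true = refl
  xor-self false = refl

  sameSide⇒nonCrossing : ∀ {f u v} → Joins G f u v → lookup VX u ≡ lookup VX v → NonCrossing f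
  sameSide⇒nonCrossing {f} {u} {v} (inj₁ x) eq = begin
    lookup (crossing G VX) f                           ≡⟨ crossing-lookup f ⟩
    lookup VX (proj₁ (ends f)) xor lookup VX (proj₂ (ends f)) ≡⟨ cong (λ p → lookup VX (proj₁ p) xor lookup VX (proj₂ p)) x ⟩
    lookup VX u xor lookup VX v                        ≡⟨ cong (lookup VX u xor_) (sym eq) ⟩
    lookup VX u xor lookup VX u                        ≡⟨ xor-self (lookup VX u) ⟩
    false                                              ∎
    where open ≡-Reasoning
  sameSide⇒nonCrossing (inj₂ x) eq = sameSide⇒nonCrossing (inj₁ x) (sym eq)

  inside⇒true : ∀ {u} → u ∈ VX → lookup VX u ≡ true
  inside⇒true = []=⇒lookup

  outside⇒false : ∀ {u} → u ∉ VX → lookup VX u ≡ false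
  outside⇒false {u} h with lookup VX u in eq
  ... | true = ⊥-elim (h (lookup⇒[]= u VX eq))
  ... | false = refl

  inside⇒nonCrossing : ∀ {f u v} → Joins G f u v → u ∈ VX → v ∈ VX → NonCrossing f
  inside⇒nonCrossing j a b = sameSide⇒nonCrossing j (trans (inside⇒true a) (sym (inside⇒true b)))

  outside⇒nonCrossing : ∀ {f u v} → Joins G f u v → u ∉ VX → v ∉ VX → NonCrossing f
  outside⇒nonCrossing j a b = sameSide⇒nonCrossing j (trans (outside⇒false a) (sym (outside⇒false b)))

  orient : ∀ f → Crossing f → Σ (Fin nV) λ x → Σ (Fin nV) λ y → x ∈ VX × y ∉ VX × Joins G f x y
  orient f c with lookup VX (proj₁ (ends f)) in e₁ | lookup VX (proj₂ (ends f)) in e₂ | crossing-lookup f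
  ... | true | false | _ =
    proj₁ (ends f) , proj₂ (ends f) , lookup⇒[]= _ VX e₁ ,
    (λ m → true≢false (trans (sym ([]=⇒lookup m)) e₂)) , inj₁ refl
  ... | false | true | _ =
    proj₂ (ends f) , proj₁ (ends f) , lookup⇒[]= _ VX e₂ ,
    (λ m → true≢false (trans (sym ([]=⇒lookup m)) e₁)) , inj₂ refl
  ... | true | true | eq = ⊥-elim (true≢false (trans (sym c) eq))
  ... | false | false | eq = ⊥-elim (true≢false (trans (sym c) eq))

enum : ∀ {n} (p : Subset n) → Fin ∣ p ∣ → Fin n
enum (true ∷ p) zero = zero
enum (true ∷ p) (suc i) = suc (enum p i)
enum (false ∷ p) i = suc (enum p i)

enum-∈ : ∀ {n} (p : Subset n) i → lookup p (enum p i) ≡ true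
enum-∈ (true ∷ p) zero = refl
enum-∈ (true ∷ p) (suc i) = enum-∈ p i
enum-∈ (false ∷ p) i = enum-∈ p i

enum-injective : ∀ {n} (p : Subset n) i j → enum p i ≡ enum p j → i ≡ j
enum-injective (true ∷ p) zero zero eq = refl
enum-injective (true ∷ p) zero (suc j) ()
enum-injective (true ∷ p) (suc i) zero ()
enum-injective (true ∷ p) (suc i) (suc j) eq = cong suc (enum-injective p i j (FinP.suc-injective eq))
enum-injective (false ∷ p) i j eq = enum-injective p i j (FinP.suc-injective eq)

module CycleWalk (G : Graph) (k′ : ℕ) (w : Walk G (suc (suc k′)))
    (closed : start G w ≡ end G w) (inj : Injective _≡_ _≡_ (edges w)) where
  open Graph G
  open InfiniteWalks G

  K : ℕ
  K = suc (suc k′)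

  Pos : Set
  Pos = Σ ℕ (_< K)

  next : Pos → Pos
  next (r , lt) with suc r <? K
  ... | yes p = suc r , p
  ... | no _ = 0 , s≤s z≤n

  pos : ℕ → Pos
  pos zero = 0 , s≤s z≤n
  pos (suc n) = next (pos n)

  toFin : Pos → Fin K
  toFin p = fromℕ< (proj₂ p)

  cv : ℕ → Fin nV
  cv n = verts w (inject₁ (toFin (pos n)))

  ce : ℕ → Fin nE
  ce n = edges w (toFin (pos n))

  next-vertex : ∀ p → verts w (suc (toFin p)) ≡ verts w (inject₁ (toFin (next p)))
  next-vertex (r , lt) with suc r <? K
  ... | yes q = cong (verts w) (toℕ-injective (trans (cong suc (toℕ-fromℕ< lt))
                                                     (sym (trans (toℕ-inject₁ (fromℕ< q)) (toℕ-fromℕ< q)))))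
  ... | no nq = trans (cong (verts w) (toℕ-injective (trans (cong suc (toℕ-fromℕ< lt))
                                                            (trans 1+r≡K (sym (toℕ-fromℕ K))))))
                      (sym closed)
    where
    1+r≡K : suc r ≡ K
    1+r≡K = ≤-antisym lt (≮⇒≥ nq)

  -- since K ≥ 2 the successor of a position is a different position
  next-≢ : ∀ p → proj₁ p ≢ proj₁ (next p)
  next-≢ (r , lt) with suc r <? K
  ... | yes q = λ e → 1+n≢n (sym e)
  ... | no nq = λ e → 1+n≢0 (suc-injective (trans (sym (≤-antisym lt (≮⇒≥ nq))) (cong suc e)))

  cycle : Seq
  cycle = mkSeq cv ce

  abstract
    cycle-NB : NBSeq cycle
    cycle-NB =
      (λ n → subst (Joins G (ce n) (cv n)) (next-vertex (pos n)) (joins w (toFin (pos n)))) ,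
      (λ n eq → next-≢ (pos n) (trans (sym (toℕ-fromℕ< (proj₂ (pos n))))
                                 (trans (cong toℕ (inj eq)) (toℕ-fromℕ< (proj₂ (pos (suc n)))))))

  module Junction (P : Fin nV → Set) where
    open FiniteWalks G P

    Joining : Fin nV → (Fin nE → Set) → Set
    Joining u H = Σ ℕ λ b → Σ ℕ λ m → Σ (PWalk u m) λ r →
       NonBacktrackingW r × endV r ≡ cv b × LastEdgeNot r (ce b) × (∀ e → H e → FirstEdgeNot e r)

    -- adding an edge in front: if the result would backtrack into the
    -- cycle, the edge itself is the next cycle edge and we join one step later
    joining-cons : ∀ {u u₁ n} e → Joins G e u u₁ → P u → (w₁ : PWalk u₁ n) → FirstEdgeNot e w₁ →
       Joining u₁ (λ g → FirstEdgeNot g w₁) → Joining u (λ g → g ≢ e)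
    joining-cons {u} {u₁} e j p _ _ (b , _ , nil p′ , _ , ev′ , _ , _) with e Fin.≟ ce b
    ... | no ne = b , 1 , cons e u₁ j p (nil p′) , (tt , tt) , ev′ , ne , λ _ h → h
    ... | yes eq =
      suc b , 0 , nil p , tt , other-end (joins-sym (proj₁ cycle-NB b)) (joins-sym j″) , tt , λ _ _ → tt
      where
      j″ : Joins G (ce b) u (cv b)
      j″ = subst₂ (λ a c → Joins G a u c) eq ev′ j
    joining-cons {u₁ = u₁} e j p _ hn (b , m , r@(cons _ _ _ _ _) , nb′ , ev′ , last , hp) =
      b , suc m , cons e u₁ j p r , (hp e hn , nb′) , ev′ , last , λ _ h → h

    joining : ∀ {u n} (r : PWalk u n) → NonBacktrackingW r → ∀ a → endV r ≡ cv a →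
      Joining u (λ g → FirstEdgeNot g r)
    joining (nil p) _ a ev = a , 0 , nil p , tt , ev , tt , λ _ _ → tt
    joining (cons e u₁ j p r) (hn , nb) a ev = joining-cons e j p r hn (joining r nb a ev)

module Construction (ℓ′ : ℕ) (G : Graph) (VX : Subset (Graph.nV G)) (EX : Subset (Graph.nE G))
    (diam : DiamLess G VX EX (suc ℓ′)) (conn : ComplementConnected G VX)
    (k′ : ℕ) (w : Walk G (suc (suc k′))) (closed : start G w ≡ end G w)
    (inj : Injective _≡_ _≡_ (edges w)) (avoid : AvoidsV G VX w) where
  open Graph G
  open LinkFacts G
  open InfiniteWalks G
  open CrossingEdges G VX
  open CycleWalk G k′ w closed inj
  module YW = FiniteWalks G (_∉ VX)
  module XW = FiniteWalks G (_∈ VX)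

  ℓ : ℕ
  ℓ = suc ℓ′

  t : ℕ
  t = crossingCount G VX

  ed : Fin t → Fin nE
  ed = enum (crossing G VX)

  ed-crossing : ∀ i → Crossing (ed i)
  ed-crossing = enum-∈ (crossing G VX)

  cycle-outside : ∀ n → cv n ∉ VX
  cycle-outside n = avoid _

  outside⇒edgesNonCrossing : ∀ S → NBSeq S → (∀ n → vs S n ∉ VX) → ∀ n → NonCrossing (es S n)
  outside⇒edgesNonCrossing S v h n = outside⇒nonCrossing (proj₁ v n) (h n) (h (suc n))

  InY : Arc G ℓ → Set
  InY A = ∀ p → verts (walk A) p ∉ VX

  InY-resp : ∀ A A′ → SameLink G (raw G A) (raw G A′) → InY A → InY A′
  InY-resp A A′ s q p =
    subst (_∉ VX) (sym (proj₂ (vertex-of-same {A = A} {A′} s p))) (q (proj₁ (vertex-of-same {A = A} {A′} s p)))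

  LeastCrossing : Fin nE → Arc G ℓ → Set
  LeastCrossing e A = (Σ (Fin ℓ) λ p → edges (walk A) p ≡ e)
                    × (∀ p → Crossing (edges (walk A) p) → toℕ e ≤ toℕ (edges (walk A) p))

  LeastCrossing-resp : ∀ e A A′ → SameLink G (raw G A) (raw G A′) → LeastCrossing e A → LeastCrossing e A′
  LeastCrossing-resp e A A′ s ((p , eq) , least) =
    (proj₁ back , trans (sym (proj₂ back)) eq) ,
    λ p′ c → subst (λ z → toℕ e ≤ toℕ z) (sym (proj₂ (there p′)))
               (least (proj₁ (there p′)) (subst Crossing (proj₂ (there p′)) c))
    where
    back = edge-of-same {A = A′} {A} (sl-sym s) p
    there = edge-of-same {A = A} {A′} s

  InY-disjoint : ∀ e A → Crossing e → InY A → LeastCrossing e A → ⊥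
  InY-disjoint e A c inY ((p , eq) , _) =
    nonCrossing⇒¬crossing (subst NonCrossing eq (outside⇒nonCrossing (joins (walk A) p) (inY _) (inY _))) c

  LeastCrossing-unique : ∀ e e′ A → Crossing e → Crossing e′ → LeastCrossing e A → LeastCrossing e′ A → toℕ e ≡ toℕ e′
  LeastCrossing-unique e e′ A c c′ ((p , eq) , least) ((p′ , eq′) , least′) =
    ≤-antisym (subst (λ z → toℕ e ≤ toℕ z) eq′ (least p′ (subst Crossing (sym eq′) c′)))
              (subst (λ z → toℕ e′ ≤ toℕ z) eq (least′ p (subst Crossing (sym eq) c)))

  window-InY : ∀ S v → (∀ n → vs S n ∉ VX) → ∀ m → InY (window ℓ S v m)
  window-InY S v h m p = h (m + toℕ p)

  window-least : ∀ S v e m n → m ≤ n → n < m + ℓ → es S n ≡ e →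
    (∀ n → m ≤ n → n < m + ℓ → Crossing (es S n) → toℕ e ≤ toℕ (es S n)) →
    LeastCrossing e (window ℓ S v m)
  window-least S v e m n m≤n n<m+ℓ eq least =
    (fromℕ< lt , trans (cong (λ z → es S (m + z)) (toℕ-fromℕ< lt)) (trans (cong (es S) (m+[n∸m]≡n m≤n)) eq)) ,
    λ p c → least (m + toℕ p) (m≤m+n m (toℕ p)) (+-monoʳ-< m (toℕ<n p)) c
    where
    lt : n ∸ m < ℓ
    lt = +-cancelˡ-< m (n ∸ m) ℓ (subst (_< m + ℓ) (sym (m+[n∸m]≡n m≤n)) n<m+ℓ)

  record RayData (y : Fin nV) : Set where
    field
      b m : ℕ
      r : YW.PWalk y m
      nb : YW.NonBacktrackingW r
      ev : YW.endV r ≡ cv b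
      last : YW.LastEdgeNot r (ce b)

  abstract
    rayData : ∀ y → y ∉ VX → RayData y
    rayData y y∉ with conn y (cv 0) y∉ (cycle-outside 0)
    ... | k , wk , avk , st , en with YW.reduceWalk k wk avk st en
    ... | _ , _ , r , nb , ev with Junction.joining (_∉ VX) r nb 0 ev
    ... | b , m , r′ , nb′ , ev′ , last , _ =
      record { b = b ; m = m ; r = r′ ; nb = nb′ ; ev = ev′ ; last = last }

  module Ray (y : Fin nV) (y∉ : y ∉ VX) where
    open RayData (rayData y y∉) public

    R : Seq
    R = YW.prependWalk r (shift cycle b)

    joinsCycle : YW.endV r ≡ vs (shift cycle b) 0
    joinsCycle = trans ev (cong cv (sym (+-identityʳ b)))

    abstract
      R-NB : NBSeq R
      R-NB = YW.prependWalk-NB r (shift cycle b) (shift-NB cycle b cycle-NB) nb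
               (subst (YW.LastEdgeNot r) (cong ce (sym (+-identityʳ b))) last) joinsCycle

    R-head : vs R 0 ≡ y
    R-head = YW.prependWalk-head r (shift cycle b) joinsCycle

    R-outside : ∀ n → vs R n ∉ VX
    R-outside = YW.prependWalk-verts r (shift cycle b) (λ q → cycle-outside (b + q))

    R-nonCrossing : ∀ n → NonCrossing (es R n)
    R-nonCrossing = outside⇒edgesNonCrossing R R-NB R-outside

  seed₀ : Arc G ℓ
  seed₀ = window ℓ cycle cycle-NB 0

  -- The ray S = xᵢ eᵢ R of the crossing edge eᵢ = xᵢyᵢ, and its first window Tᵢ,
  -- the seed of Bᵢ.  Tᵢ is adjacent to the first window of R, which lies in B₀.
  module CrossRay (i : Fin t) where
    private
      o = orient (ed i) (ed-crossing i)
    x y : Fin nV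
    x = proj₁ o
    y = proj₁ (proj₂ o)
    x∈ : x ∈ VX
    x∈ = proj₁ (proj₂ (proj₂ o))
    y∉ : y ∉ VX
    y∉ = proj₁ (proj₂ (proj₂ (proj₂ o)))
    xy : Joins G (ed i) x y
    xy = proj₂ (proj₂ (proj₂ (proj₂ o)))

    open Ray y y∉ public

    S : Seq
    S = prepend x (ed i) R

    abstract
      S-NB : NBSeq S
      S-NB = prepend-NB R-NB (subst (Joins G (ed i) x) (sym R-head) xy)
               (λ eq → nonCrossing⇒¬crossing (R-nonCrossing 0) (subst Crossing eq (ed-crossing i)))

    S-edges : ∀ n → NonCrossing (es S n) ⊎ es S n ≡ ed i
    S-edges zero = inj₂ refl
    S-edges (suc n) = inj₁ (R-nonCrossing n)

    T : Arc G ℓ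
    T = window ℓ S S-NB 0

    T-least : LeastCrossing (ed i) T
    T-least = window-least S S-NB (ed i) 0 0 z≤n (s≤s z≤n) refl least
      where
      least : ∀ n → 0 ≤ n → n < ℓ → Crossing (es S n) → toℕ (ed i) ≤ toℕ (es S n)
      least zero _ _ _ = ≤-refl
      least (suc n) _ _ c = ⊥-elim (nonCrossing⇒¬crossing (R-nonCrossing n) c)

    open Chains G ℓ InY InY-resp
    module WC = Windows ℓ cycle cycle-NB
    module WR = Windows ℓ R R-NB
    module WS = Windows ℓ S S-NB

    -- from seed₀ along the cycle to window b, which is window m of R, then
    -- back along R to its first window
    seed₀-to-R : Chain seed₀ (WR.win 0)
    seed₀-to-R =
      append (WC.slide InY InY-resp 0 b (λ n _ _ → window-InY cycle cycle-NB cycle-outside n))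
             (reverse (WR.slide InY InY-resp 0 m (λ n _ _ → window-InY R R-NB R-outside n)))
             (inj₁ ((λ q → sym (YW.prependWalk-far-v r (shift cycle b) (toℕ q))) ,
                    (λ q → sym (YW.prependWalk-far-e r (shift cycle b) (toℕ q)))))

    R-adj-T : LinkAdj G ℓ (WR.win 0) T
    R-adj-T = adj-sym {L = T} {R = WR.win 0}
      (adj-respʳ {L = T} {R = WS.win 1} {R′ = WR.win 0} (sl-refl _) (WS.win-adj 0))

  record XPath (u v : Fin nV) : Set where
    field
      d : ℕ
      d≤ℓ′ : d ≤ ℓ′
      p : XW.PWalk u d
      nb : XW.NonBacktrackingW p
      ev : XW.endV p ≡ v

  abstract
    xPath : ∀ u v → u ∈ VX → v ∈ VX → XPath u v
    xPath u v u∈ v∈ with diam u v u∈ v∈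
    ... | k , k<ℓ , wk , (wv , _) , st , en with XW.reduceWalk k wk wv st en
    ... | d , d≤k , p , nb , ev = record { d = d ; d≤ℓ′ = ≤-trans d≤k (s≤s⁻¹ k<ℓ) ; p = p ; nb = nb ; ev = ev }

  xPath-nonCrossing : ∀ {u n} (p : XW.PWalk u n) → XW.AllEdges NonCrossing p
  xPath-nonCrossing = XW.allEdges-of NonCrossing (λ e a b a∈ b∈ j → inside⇒nonCrossing j a∈ b∈)

  CrossesOnlyAt : Fin nE → Fin nE → Set
  CrossesOnlyAt e f = NonCrossing f ⊎ f ≡ e

  -- The walk D runs the first ℓ steps of Sⱼ
  -- backwards into X (ending with eⱼ), follows a path p of length d < ℓ in X
  -- from xⱼ to xᵢ, and continues along Sᵢ.  Its windows 0, …, d contain eⱼ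
  -- and no other crossing edge, the windows d+1, …, ℓ+d contain eᵢ and no
  -- crossing edge other than eᵢ, eⱼ; window 0 is Tⱼ reversed and window ℓ+d is Tᵢ.
  module Pair (i j : Fin t) (eᵢ<eⱼ : toℕ (ed i) < toℕ (ed j)) where
    module I = CrossRay i
    module J = CrossRay j
    open XPath (xPath J.x I.x J.x∈ I.x∈)

    F : Seq
    F = XW.prependWalk p I.S

    abstract
      F-NB : NBSeq F
      F-NB = XW.prependWalk-NB p I.S I.S-NB nb
               (XW.lastEdgeNot-from-all NonCrossing (ed i) (λ nc → nonCrossing⇒¬crossing nc (ed-crossing i))
                  p (xPath-nonCrossing p))
               ev

    F-head : vs F 0 ≡ J.x
    F-head = XW.prependWalk-head p I.S ev

    p-edges : ∀ e → XW.AllEdges (CrossesOnlyAt e) p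
    p-edges e = XW.allEdges-map inj₁ p (xPath-nonCrossing p)

    F-edges : ∀ n → CrossesOnlyAt (ed i) (es F n)
    F-edges n = XW.prependWalk-edges (CrossesOnlyAt (ed i)) p I.S (suc n) (p-edges (ed i)) (λ n′ _ → I.S-edges n′) n
                  (subst (n <_) (sym (+-suc d n)) (s≤s (m≤n+m n d)))

    -- the junction at xⱼ does not backtrack: eⱼ is neither in X nor eᵢ
    junction : es J.S 0 ≢ es F 0
    junction eq with F-edges 0
    ... | inj₁ nc = nonCrossing⇒¬crossing (subst NonCrossing (sym eq) nc) (ed-crossing j)
    ... | inj₂ e = <-irrefl (cong toℕ (sym (trans eq e))) eᵢ<eⱼ

    D : Seq
    D = revPre J.S ℓ F

    abstract
      D-NB : NBSeq D
      D-NB = revPre-NB J.S ℓ F J.S-NB F-NB F-head junction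

    D-edges : ∀ n → NonCrossing (es D n) ⊎ es D n ≡ ed i ⊎ es D n ≡ ed j
    D-edges n = revPre-edges Allowed J.S ℓ F (suc n) fromS fromF n
                  (≤-trans (s≤s (m≤n+m n ℓ)) (≤-reflexive (sym (+-suc ℓ n))))
      where
      Allowed : Fin nE → Set
      Allowed f = NonCrossing f ⊎ f ≡ ed i ⊎ f ≡ ed j
      fromS : ∀ n → Allowed (es J.S n)
      fromS n with J.S-edges n
      ... | inj₁ x = inj₁ x
      ... | inj₂ x = inj₂ (inj₂ x)
      fromF : EdgesUpTo Allowed F (suc n)
      fromF n′ _ with F-edges n′
      ... | inj₁ x = inj₁ x
      ... | inj₂ x = inj₂ (inj₁ x)

    D-edges-early : ∀ n → n < ℓ + d → CrossesOnlyAt (ed j) (es D n)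
    D-edges-early n n< = revPre-edges (CrossesOnlyAt (ed j)) J.S ℓ F d J.S-edges fromF n n<
      where
      fromF : EdgesUpTo (CrossesOnlyAt (ed j)) F d
      fromF n′ n′< = XW.prependWalk-edges (CrossesOnlyAt (ed j)) p I.S 0 (p-edges (ed j)) (λ _ ()) n′
                       (subst (n′ <_) (sym (+-identityʳ d)) n′<)

    D-eⱼ : es D ℓ′ ≡ ed j
    D-eⱼ = trans (revPre-near-e J.S ℓ F ℓ′ ≤-refl) (cong (es J.S) (n∸n≡0 ℓ′))

    D-eᵢ : es D (ℓ + d) ≡ ed i
    D-eᵢ = trans (revPre-far-e J.S ℓ F d) (trans (cong (es F) (sym (+-identityʳ d))) (XW.prependWalk-far-e p I.S 0))

    module WD = Windows ℓ D D-NB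

    Tⱼ-first : SameLink G (raw G J.T) (raw G (WD.win 0))
    Tⱼ-first = sl-sym {r = raw G (WD.win 0)} {s = raw G J.T} (inj₂ (
      (λ q → trans (revPre-near-v J.S ℓ F (toℕ q) (s≤s⁻¹ (toℕ<n q)) F-head) (cong (vs J.S) (sym (opposite-prop q)))) ,
      (λ q → trans (revPre-near-e J.S ℓ F (toℕ q) (toℕ<n q)) (cong (es J.S) (sym (opposite-prop q))))))

    Tᵢ-last : SameLink G (raw G (WD.win (ℓ + d))) (raw G I.T)
    Tᵢ-last = inj₁ (
      (λ q → trans (cong (vs D) (+-assoc ℓ d (toℕ q)))
               (trans (revPre-far-v J.S ℓ F (d + toℕ q)) (XW.prependWalk-far-v p I.S (toℕ q)))) ,
      (λ q → trans (cong (es D) (+-assoc ℓ d (toℕ q)))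
               (trans (revPre-far-e J.S ℓ F (d + toℕ q)) (XW.prependWalk-far-e p I.S (toℕ q)))))

    module CJ = Chains G ℓ (LeastCrossing (ed j)) (LeastCrossing-resp (ed j))
    module CI = Chains G ℓ (LeastCrossing (ed i)) (LeastCrossing-resp (ed i))

    early-least : ∀ m → 0 ≤ m → m ≤ 0 + d → LeastCrossing (ed j) (WD.win m)
    early-least m _ m≤d = window-least D D-NB (ed j) m ℓ′ (≤-trans m≤d d≤ℓ′) (m≤n+m ℓ m) D-eⱼ least
      where
      least : ∀ n → m ≤ n → n < m + ℓ → Crossing (es D n) → toℕ (ed j) ≤ toℕ (es D n)
      least n _ n< c with D-edges-early n (<-≤-trans n< (≤-trans (+-monoˡ-≤ ℓ m≤d) (≤-reflexive (+-comm d ℓ))))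
      ... | inj₁ nc = ⊥-elim (nonCrossing⇒¬crossing nc c)
      ... | inj₂ e = ≤-reflexive (cong toℕ (sym e))

    chainⱼ : CJ.Chain J.T (WD.win d)
    chainⱼ = CJ.restart Tⱼ-first J.T-least (WD.slide (LeastCrossing (ed j)) (LeastCrossing-resp (ed j)) 0 d early-least)

    late-end : suc d + ℓ′ ≡ ℓ + d
    late-end = cong suc (+-comm d ℓ′)

    late-least : ∀ m → suc d ≤ m → m ≤ suc d + ℓ′ → LeastCrossing (ed i) (WD.win m)
    late-least m d<m m≤ = window-least D D-NB (ed i) m (ℓ + d) (≤-trans m≤ (≤-reflexive late-end))
                            (<-≤-trans (≤-reflexive (cong suc (+-comm ℓ d))) (+-monoˡ-≤ ℓ d<m)) D-eᵢ least
      where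
      least : ∀ n → m ≤ n → n < m + ℓ → Crossing (es D n) → toℕ (ed i) ≤ toℕ (es D n)
      least n _ _ c with D-edges n
      ... | inj₁ nc = ⊥-elim (nonCrossing⇒¬crossing nc c)
      ... | inj₂ (inj₁ e) = ≤-reflexive (cong toℕ (sym e))
      ... | inj₂ (inj₂ e) = subst (λ z → toℕ (ed i) ≤ toℕ z) (sym e) (<⇒≤ eᵢ<eⱼ)

    chainᵢ : CI.Chain I.T (WD.win (suc d))
    chainᵢ = CI.reverse (CI.extend (WD.slide (LeastCrossing (ed i)) (LeastCrossing-resp (ed i)) (suc d) ℓ′ late-least)
                                   (sl-trans (WD.win-cong late-end) Tᵢ-last))

    touching : Touching {ℓ} (CI.Chain I.T) (CJ.Chain J.T)
    touching = touching-sym {B = CJ.Chain J.T} {B′ = CI.Chain I.T} (WD.win d , WD.win (suc d) , chainⱼ , chainᵢ , WD.win-adj d)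

  module B₀ = Chains.BranchSet G ℓ InY InY-resp seed₀
  module Bₑ (i : Fin t) = Chains.BranchSet G ℓ (LeastCrossing (ed i)) (LeastCrossing-resp (ed i)) (CrossRay.T i)

  branch : Fin (suc t) → LinkSet G ℓ
  branch zero = B₀.Branch
  branch (suc i) = Bₑ.Branch i

  branch-resp : ∀ i → RespectsLink G (branch i)
  branch-resp zero = B₀.branch-resp
  branch-resp (suc i) = Bₑ.branch-resp i

  branch-nonempty : ∀ i → Σ (Arc G ℓ) (branch i)
  branch-nonempty zero = B₀.branch-nonempty (window-InY cycle cycle-NB cycle-outside 0)
  branch-nonempty (suc i) = Bₑ.branch-nonempty i (CrossRay.T-least i)

  branch-connected : ∀ i → ConnectedIn G ℓ (branch i)
  branch-connected zero = B₀.branch-connected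
  branch-connected (suc i) = Bₑ.branch-connected i

  inB₀ : ∀ {A} → branch zero A → InY A
  inB₀ = Chains.chain-end G ℓ InY InY-resp

  inBₑ : ∀ i {A} → branch (suc i) A → LeastCrossing (ed i) A
  inBₑ i = Chains.chain-end G ℓ (LeastCrossing (ed i)) (LeastCrossing-resp (ed i))

  branch-disjoint : ∀ i j → i ≢ j → ∀ (A : Arc G ℓ) → branch i A → ¬ branch j A
  branch-disjoint zero zero i≢j _ _ _ = i≢j refl
  branch-disjoint zero (suc j) _ A a b = InY-disjoint (ed j) A (ed-crossing j) (inB₀ a) (inBₑ j b)
  branch-disjoint (suc i) zero _ A a b = InY-disjoint (ed i) A (ed-crossing i) (inB₀ b) (inBₑ i a)
  branch-disjoint (suc i) (suc j) i≢j A a b =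
    i≢j (cong suc (enum-injective (crossing G VX) i j (toℕ-injective
      (LeastCrossing-unique (ed i) (ed j) A (ed-crossing i) (ed-crossing j) (inBₑ i a) (inBₑ j b)))))

  B₀-touches : ∀ i → Touching {ℓ} (branch zero) (branch (suc i))
  B₀-touches i = CrossRay.WR.win i 0 , CrossRay.T i , CrossRay.seed₀-to-R i ,
                 proj₂ (Bₑ.branch-nonempty i (CrossRay.T-least i)) , CrossRay.R-adj-T i

  branch-touching : ∀ i j → i ≢ j → Touching {ℓ} (branch i) (branch j)
  branch-touching zero zero i≢j = ⊥-elim (i≢j refl)
  branch-touching zero (suc j) _ = B₀-touches j
  branch-touching (suc i) zero _ = touching-sym {B = branch zero} {B′ = branch (suc i)} (B₀-touches i)
  branch-touching (suc i) (suc j) i≢j with <-cmp (toℕ (ed i)) (toℕ (ed j))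
  ... | tri< lt _ _ = Pair.touching i j lt
  ... | tri≈ _ eq _ = ⊥-elim (i≢j (cong suc (enum-injective (crossing G VX) i j (toℕ-injective eq))))
  ... | tri> _ _ gt = touching-sym {B = branch (suc j)} {B′ = branch (suc i)} (Pair.touching j i gt)

  minor : HasCompleteMinorInLinkGraph G ℓ (suc t)
  minor = branch , branch-resp , branch-nonempty , branch-connected , branch-disjoint , branch-touching

mainTheorem17 : (ℓ : ℕ) → 1 ≤ ℓ → (G : Graph) →
    (VX : Subset (Graph.nV G)) → (EX : Subset (Graph.nE G)) →
    IsSubgraph G VX EX →
    DiamLess G VX EX ℓ →
    ComplementConnected G VX →
    ComplementHasCycle G VX →
    HasCompleteMinorInLinkGraph G ℓ (suc (crossingCount G VX))
mainTheorem17 zero () _ _ _ _ _ _ _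
mainTheorem17 (suc ℓ′) _ G VX EX _ diam conn (suc (suc k′) , s≤s (s≤s z≤n) , w , closed , _ , inj , avoid) =
  Construction.minor ℓ′ G VX EX diam conn k′ w closed inj avoid
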